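{- (1) If $\mathcal{A}=(\mathcal{M},m)$ is a pseudo-arithmetic matroid on a finite set $E$, then all coefficients of the arithmetic Tutte polynomial $M_\mathcal{A}(x,y)$ are nonnegative. (2) Conversely, let $\mathcal{M}$ be a matroid on $E$ with rank function $\rk$ and let $m:2^E\to\mathbb{R}$. Suppose that for all disjoint $R,D\subseteq E$, the pair $(\rk',m')$ on ground set $E'=E\setminus(R\cup D)$ given by $\rk'(A)=\rk(A\cup R)-\rk(R)$ and $m'(A)=m(A\cup R)$ (obtained by contracting $R$ and deleting $D$) has arithmetic Tutte polynomial $\sum_{A\subseteq E'}m'(A)(x-1)^{\rk'(E')-\rk'(A)}(y-1)^{|A|-\rk'(A)}$ with nonnegative coefficients. Then $(\mathcal{M},m)$ is a pseudo-arithmetic matroid.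
   Context: A matroid on a finite set $E$ is given by a rank function $\rk:2^E\to\mathbb{N}$ with $\rk(\emptyset)=0$, monotone, and submodular. For $R\subseteq S\subseteq E$ let $[R,S]=\{A:R\subseteq A\subseteq S\}$; it is a molecule if $S$ is a disjoint union $S=R\cup F\cup T$ with $\rk(A)=\rk(R)+|A\cap F|$ for all $A\in[R,S]$, and then $\rho(R,S):=(-1)^{|T|}\sum_{A\in[R,S]}(-1)^{|S|-|A|}m(A)$. A pseudo-arithmetic matroid is a matroid with a function $m:2^E\to\mathbb{R}$ such that $\rho(R,S)\ge0$ for every molecule $[R,S]$. Its arithmetic Tutte polynomial is $M_\mathcal{A}(x,y)=\sum_{A\subseteq E}m(A)(x-1)^{\rk(E)-\rk(A)}(y-1)^{|A|-\rk(A)}$. -}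

module Defs where

open import Level using (Level; suc; _⊔_)
open import Data.Nat as ℕ using (ℕ; zero; _∸_)
import Data.Nat
open import Data.Bool using (true; false)
open import Data.List using (List; []; _∷_; map; _++_; foldr; filter)
open import Data.Vec using (Vec; []; _∷_)
open import Data.Fin.Subset using (Subset; _⊆_; _∪_; _∩_; _─_; ∣_∣; ⊥; ⊤; inside; outside)
open import Data.Fin.Subset.Properties using (_⊆?_)
open import Data.Product using (_×_)
open import Algebra.Bundles using (CommutativeRing)
open import Relation.Binary.Structures using (IsTotalOrder)
open import Relation.Binary.PropositionalEquality using (_≡_)

-- Coefficient domain: a totally ordered commutative ring (ℝ is one;
-- ℝ itself is not available in agda-stdlib).

record OrderedCommutativeRing (c ℓ₁ ℓ₂ : Level) : Set (suc (c ⊔ ℓ₁ ⊔ ℓ₂)) where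
  field
    commutativeRing : CommutativeRing c ℓ₁
  open CommutativeRing commutativeRing public
  infix 4 _≤_
  field
    _≤_         : Carrier → Carrier → Set ℓ₂
    isTotalOrder : IsTotalOrder _≈_ _≤_
    +-monoˡ-≤   : ∀ {x y} z → x ≤ y → x + z ≤ y + z
    *-nonneg    : ∀ {x y} → 0# ≤ x → 0# ≤ y → 0# ≤ x * y

allSubsets : (n : ℕ) → List (Subset n)
allSubsets zero    = [] ∷ []
allSubsets (ℕ.suc n) =
  map (outside ∷_) (allSubsets n) ++ map (inside ∷_) (allSubsets n)

interval : {n : ℕ} → Subset n → Subset n → List (Subset n)
interval {n} R S = filter (λ A → A ⊆? S) (filter (λ A → R ⊆? A) (allSubsets n))

Disjoint : {n : ℕ} → Subset n → Subset n → Set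
Disjoint A B = A ∩ B ≡ ⊥

record IsMatroid {n : ℕ} (rk : Subset n → ℕ) : Set where
  field
    rk-empty      : rk ⊥ ≡ 0
    rk-bounded    : ∀ A → rk A Data.Nat.≤ ∣ A ∣
    rk-monotone   : ∀ {A B} → A ⊆ B → rk A Data.Nat.≤ rk B
    rk-submodular : ∀ A B → rk (A ∪ B) Data.Nat.+ rk (A ∩ B) Data.Nat.≤ rk A Data.Nat.+ rk B

contractRk : {n : ℕ} → (Subset n → ℕ) → Subset n → Subset n → ℕ
contractRk rk R A = rk (A ∪ R) ∸ rk R

module _ {c ℓ₁ ℓ₂} (𝕂 : OrderedCommutativeRing c ℓ₁ ℓ₂) where
  open OrderedCommutativeRing 𝕂 using (Carrier; _+_; _*_; -_; 0#; 1#; _≤_)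

  Σ-list : {X : Set} → List X → (X → Carrier) → Carrier
  Σ-list xs f = foldr (λ x acc → f x + acc) 0# xs

  sign : ℕ → Carrier
  sign zero      = 1#
  sign (ℕ.suc k) = - sign k

  -- coefficient of t^i in the univariate polynomial (t - 1)^a,
  -- computed by repeated multiplication by (t - 1)
  powCoeff : ℕ → ℕ → Carrier
  powCoeff zero      zero      = 1#
  powCoeff zero      (ℕ.suc i) = 0#
  powCoeff (ℕ.suc a) zero      = - powCoeff a zero
  powCoeff (ℕ.suc a) (ℕ.suc i) = powCoeff a i + - powCoeff a (ℕ.suc i)

  -- Coefficient of x^i y^j in the arithmetic Tutte polynomial of (rk, m)
  -- on ground set G ⊆ Fin n (subsets of G are the subsets of Fin n
  -- contained in G):
  --   Σ_{A ⊆ G} m(A) (x-1)^{rk G - rk A} (y-1)^{|A| - rk A}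
  tutteCoeff : {n : ℕ} → (Subset n → ℕ) → (Subset n → Carrier) →
               Subset n → ℕ → ℕ → Carrier
  tutteCoeff rk m G i j =
    Σ-list (interval ⊥ G) (λ A →
      m A * (powCoeff (rk G ∸ rk A) i * powCoeff (∣ A ∣ ∸ rk A) j))

  NonnegTutte : {n : ℕ} → (Subset n → ℕ) → (Subset n → Carrier) → Subset n → Set ℓ₂
  NonnegTutte rk m G = ∀ i j → 0# ≤ tutteCoeff rk m G i j

  record IsMolecule {n : ℕ} (rk : Subset n → ℕ) (R S F T : Subset n) : Set where
    field
      R∩F   : Disjoint R F
      R∩T   : Disjoint R T
      F∩T   : Disjoint F T
      S≡    : S ≡ R ∪ F ∪ T
      rank≡ : ∀ A → R ⊆ A → A ⊆ S → rk A ≡ rk R Data.Nat.+ ∣ A ∩ F ∣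

  ρ : {n : ℕ} → (Subset n → Carrier) → (R S T : Subset n) → Carrier
  ρ m R S T = sign ∣ T ∣ * Σ-list (interval R S) (λ A → sign (∣ S ∣ ∸ ∣ A ∣) * m A)

  IsPseudoArithmetic : {n : ℕ} → (Subset n → ℕ) → (Subset n → Carrier) → Set ℓ₂
  IsPseudoArithmetic {n} rk m =
    IsMatroid rk × (∀ (R S F T : Subset n) → IsMolecule rk R S F T → 0# ≤ ρ m R S T)

  -- contraction of R (deletion of D is realized by restricting the ground set)
  contractM : {n : ℕ} → (Subset n → Carrier) → Subset n → Subset n → Carrier
  contractM m R A = m (A ∪ R)

-- Both directions come from the first element e of the ground set.  Splitting
-- the defining sum by whether A contains e gives the deletion–contraction
-- recursion for the arithmetic Tutte polynomial M of (rk, m): M = M∖e + M/e when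
-- e is neither a loop nor a coloop; when e is a loop,
-- [xⁱyʲ⁺¹] M = [xⁱyʲ] M/e + [xⁱyʲ⁺¹] M′ and [xⁱy⁰] M = [xⁱy⁰] M′, where M′ is the
-- polynomial of the deletion weighted by m(A) − m(A ∪ e); dually in x for a
-- coloop, with weight m(A ∪ e) − m(A).  Each of these minors is again
-- pseudo-arithmetic: a molecule of the minor, extended by e (into T for a loop,
-- into F for a coloop), is a molecule of rk with the same ρ.  Induction on the
-- ground set ends with m(∅) = ρ(∅, ∅) ≥ 0.
-- Conversely, ρ(R, S) is the constant term of M for the minor obtained by
-- contracting R and deleting E ∖ S: on [R, S] the rank is rk R + |A ∩ F|, so the
-- constant term of each summand is (−1)^((|F| − |A ∩ F|) + (|A ∖ R| − |A ∩ F|)),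
-- which is the sign (−1)^(|T| + |S| − |A|) in ρ.

module Submission where

open import Defs
open import Level using (Level)
open import Data.Nat using (ℕ)
open import Data.Product using (_×_)
open import Data.Fin.Subset using (Subset; ⊤; _∪_; _─_)

open import Data.Nat as ℕ using (zero; suc; _∸_)
import Data.Nat.Properties as ℕ
open import Data.Nat.Tactic.RingSolver using (solve-∀)
open import Data.Bool using (true; false; if_then_else_; _∧_; _∨_)
open import Data.List using (List; []; _∷_; map; _++_; filter)
open import Data.Fin using (Fin)
open import Data.Vec using ([]; _∷_; here; there)
open import Data.Vec.Properties using (∷-injectiveˡ; ∷-injectiveʳ)
open import Data.Fin.Subset using (⊥; ∁; _∩_; _⊆_; _∈_; _∉_; ∣_∣; inside; outside)
open import Data.Fin.Subset.Properties
  using ( _⊆?_; ∉⊥; ∈⊤; ⊥⊆; ⊆⊤; ⊆-refl; ⊆-antisym; out⊆; s⊆s; drop-∷-⊆; Empty-unique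
        ; ∣⊥∣≡0; p⊆q⇒∣p∣≤∣q∣; ∣p∩q∣≤∣p∣; ∣p∩q∣≤∣q∣
        ; p⊆p∪q; q⊆p∪q; x∈p∪q⁺; x∈p∪q⁻; p∩q⊆q; x∈p∩q⁺; x∈p∩q⁻
        ; x∉∁p⇒x∈p; x∈∁p⇒x∉p; x∈p∧x∉q⇒x∈p─q
        ; ∩-distribˡ-∪; ∩-distribʳ-∪; ∪-identityˡ; ∪-identityʳ )
open import Data.Product using (_,_)
open import Data.Sum using (inj₁; inj₂; [_,_]′)
open import Function using (_∘_)
open import Relation.Nullary using (Dec; does; yes; no; contradiction)
open import Relation.Binary.PropositionalEquality as ≡ using (_≡_)
open import Relation.Binary.Structures using (IsTotalOrder)
import Algebra.Properties.Ring as RingProperties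
import Algebra.Properties.AbelianGroup as AbelianGroupProperties
import Algebra.Properties.CommutativeSemigroup as CommutativeSemigroupProperties

private variable
  n : ℕ
  x : Fin n
  A B p q : Subset n

module _ where
  open import Data.Nat using (_+_; _≤_)

  p⊆q⇒q∪p≡q : p ⊆ q → q ∪ p ≡ q
  p⊆q⇒q∪p≡q {p = p} {q} p⊆q = ⊆-antisym q∪p⊆q (p⊆p∪q p)
    where
    q∪p⊆q : q ∪ p ⊆ q
    q∪p⊆q x∈q∪p with x∈p∪q⁻ q p x∈q∪p
    ... | inj₁ x∈q = x∈q
    ... | inj₂ x∈p = p⊆q x∈p

  p⊆q⇒q∩p≡p : p ⊆ q → q ∩ p ≡ p
  p⊆q⇒q∩p≡p {p = p} {q} p⊆q = ⊆-antisym (p∩q⊆q q p) λ x∈p → x∈p∩q⁺ (p⊆q x∈p , x∈p)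

  ∣p∪q∣≡∣p∣+∣q∣ : Disjoint p q → ∣ p ∪ q ∣ ≡ ∣ p ∣ + ∣ q ∣
  ∣p∪q∣≡∣p∣+∣q∣ {p = []}          {[]}          _   = ≡.refl
  ∣p∪q∣≡∣p∣+∣q∣ {p = outside ∷ p} {outside ∷ q} p∩q = ∣p∪q∣≡∣p∣+∣q∣ (∷-injectiveʳ p∩q)
  ∣p∪q∣≡∣p∣+∣q∣ {p = inside  ∷ p} {outside ∷ q} p∩q =
    ≡.cong suc (∣p∪q∣≡∣p∣+∣q∣ (∷-injectiveʳ p∩q))
  ∣p∪q∣≡∣p∣+∣q∣ {p = outside ∷ p} {inside  ∷ q} p∩q =
    ≡.trans (≡.cong suc (∣p∪q∣≡∣p∣+∣q∣ (∷-injectiveʳ p∩q))) (≡.sym (ℕ.+-suc ∣ p ∣ ∣ q ∣))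
  ∣p∪q∣≡∣p∣+∣q∣ {p = inside  ∷ p} {inside  ∷ q} p∩q with () ← ∷-injectiveˡ p∩q

  disjoint⁺ : (∀ {x} → x ∈ p → x ∉ q) → Disjoint p q
  disjoint⁺ {p = p} {q} p∌q = Empty-unique λ (x , x∈p∩q) →
    let x∈p , x∈q = x∈p∩q⁻ p q x∈p∩q in p∌q x∈p x∈q

  disjoint⁻ : Disjoint p q → x ∈ p → x ∉ q
  disjoint⁻ p∩q≡⊥ x∈p x∈q = ∉⊥ (≡.subst (_ ∈_) p∩q≡⊥ (x∈p∩q⁺ (x∈p , x∈q)))

  x∈p─q⇒x∉q : x ∈ p ─ q → x ∉ q
  x∈p─q⇒x∉q {p = inside ∷ p} {outside ∷ q} here        ()
  x∈p─q⇒x∉q {p = _      ∷ p} {_       ∷ q} (there x∈) (there x∈q) = x∈p─q⇒x∉q x∈ x∈q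

  -- The rank axioms up to the additive constant rk ⊥, as satisfied by the rank of
  -- a contraction on the remaining elements.  Accordingly nullity below is
  -- |A| + rk ⊥ − rk A, where the truncated subtraction is exact by rk-bounded.
  record IsShiftedMatroid {n : ℕ} (rk : Subset n → ℕ) : Set where
    field
      rk-monotone   : A ⊆ B → rk A ≤ rk B
      rk-submodular : ∀ A B → rk (A ∪ B) + rk (A ∩ B) ≤ rk A + rk B
      rk-bounded    : ∀ A → rk A ≤ ∣ A ∣ + rk ⊥

  ∣A∣+rk⊥≡∣A∣ : {rk : Subset n → ℕ} → IsMatroid rk → ∀ (A : Subset n) → ∣ A ∣ + rk ⊥ ≡ ∣ A ∣
  ∣A∣+rk⊥≡∣A∣ isMatroid A =
    ≡.trans (≡.cong (∣ A ∣ +_) (IsMatroid.rk-empty isMatroid)) (ℕ.+-identityʳ ∣ A ∣)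

  isMatroid⇒isShiftedMatroid : {rk : Subset n → ℕ} → IsMatroid rk → IsShiftedMatroid rk
  isMatroid⇒isShiftedMatroid {rk = rk} isMatroid = record
    { rk-monotone   = rk-monotone
    ; rk-submodular = rk-submodular
    ; rk-bounded    = λ A → ≡.subst (rk A ≤_) (≡.sym (∣A∣+rk⊥≡∣A∣ isMatroid A)) (rk-bounded A)
    }
    where open IsMatroid isMatroid

  deleteFirst contractFirst : ∀ {a} {X : Set a} → (Subset (suc n) → X) → Subset n → X
  deleteFirst   f A = f (outside ∷ A)
  contractFirst f A = f (inside ∷ A)

  corank nullity : (Subset n → ℕ) → Subset n → ℕ
  corank  rk A = rk ⊤ ∸ rk A
  nullity rk A = ∣ A ∣ + rk ⊥ ∸ rk A

  data FirstElement {n : ℕ} (rk : Subset (suc n) → ℕ) : Set where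
    loop    : (∀ A → contractFirst rk A ≡ deleteFirst rk A) → FirstElement rk
    coloop  : (∀ A → contractFirst rk A ≡ suc (deleteFirst rk A)) → FirstElement rk
    neither : contractFirst rk ⊥ ≡ suc (deleteFirst rk ⊥) →
              contractFirst rk ⊤ ≡ deleteFirst rk ⊤ → FirstElement rk

  module _ {rk : Subset (suc n) → ℕ} (isRk : IsShiftedMatroid rk) where
    open IsShiftedMatroid isRk
    open ℕ.≤-Reasoning

    private
      rk₀ rk₁ : Subset n → ℕ
      rk₀ = deleteFirst rk
      rk₁ = contractFirst rk

    contractFirst-gain-antitone : A ⊆ B → rk₁ B + rk₀ A ≤ rk₀ B + rk₁ A
    contractFirst-gain-antitone {A} {B} A⊆B =
      ≡.subst₂ (λ X Y → rk (inside ∷ X) + rk (outside ∷ Y) ≤ rk₀ B + rk₁ A)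
               (p⊆q⇒q∪p≡q A⊆B) (p⊆q⇒q∩p≡p A⊆B)
               (rk-submodular (outside ∷ B) (inside ∷ A))

    deleteFirst≤contractFirst : ∀ A → rk₀ A ≤ rk₁ A
    deleteFirst≤contractFirst A = rk-monotone (out⊆ ⊆-refl)

    contractFirst≤1+deleteFirst : ∀ A → rk₁ A ≤ suc (rk₀ A)
    contractFirst≤1+deleteFirst A = ℕ.+-cancelʳ-≤ (rk₀ ⊥) (rk₁ A) (suc (rk₀ A)) (begin
      rk₁ A + rk₀ ⊥        ≤⟨ contractFirst-gain-antitone ⊥⊆ ⟩
      rk₀ A + rk₁ ⊥        ≤⟨ ℕ.+-monoʳ-≤ (rk₀ A) rk₁⊥≤1+rk₀⊥ ⟩
      rk₀ A + suc (rk₀ ⊥)  ≡⟨ ℕ.+-suc (rk₀ A) (rk₀ ⊥) ⟩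
      suc (rk₀ A) + rk₀ ⊥  ∎)
      where
      rk₁⊥≤1+rk₀⊥ : rk₁ ⊥ ≤ suc (rk₀ ⊥)
      rk₁⊥≤1+rk₀⊥ =
        ≡.subst (λ k → rk₁ ⊥ ≤ suc k + rk₀ ⊥) (∣⊥∣≡0 n) (rk-bounded (inside ∷ ⊥))

    deleteFirst-isShiftedMatroid : IsShiftedMatroid rk₀
    deleteFirst-isShiftedMatroid = record
      { rk-monotone   = λ A⊆B → rk-monotone (out⊆ A⊆B)
      ; rk-submodular = λ A B → rk-submodular (outside ∷ A) (outside ∷ B)
      ; rk-bounded    = λ A → rk-bounded (outside ∷ A)
      }

    contractFirst-isShiftedMatroid : IsShiftedMatroid rk₁
    contractFirst-isShiftedMatroid = record
      { rk-monotone   = λ A⊆B → rk-monotone (s⊆s A⊆B)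
      ; rk-submodular = λ A B → rk-submodular (inside ∷ A) (inside ∷ B)
      ; rk-bounded    = bounded
      }
      where
      bounded : ∀ A → rk₁ A ≤ ∣ A ∣ + rk₁ ⊥
      bounded A = ℕ.+-cancelʳ-≤ (rk₀ ⊥) (rk₁ A) (∣ A ∣ + rk₁ ⊥) (begin
        rk₁ A + rk₀ ⊥          ≤⟨ contractFirst-gain-antitone ⊥⊆ ⟩
        rk₀ A + rk₁ ⊥          ≤⟨ ℕ.+-monoˡ-≤ (rk₁ ⊥) (rk-bounded (outside ∷ A)) ⟩
        ∣ A ∣ + rk₀ ⊥ + rk₁ ⊥  ≡⟨ swap ∣ A ∣ (rk₀ ⊥) (rk₁ ⊥) ⟩
        ∣ A ∣ + rk₁ ⊥ + rk₀ ⊥  ∎)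
        where
        swap : ∀ a x y → a + x + y ≡ a + y + x
        swap = solve-∀

    contractFirst-loop : rk₁ ⊥ ≡ rk₀ ⊥ → ∀ A → rk₁ A ≡ rk₀ A
    contractFirst-loop loop⊥ A = ℕ.≤-antisym
      (ℕ.+-cancelʳ-≤ (rk₀ ⊥) (rk₁ A) (rk₀ A) (begin
        rk₁ A + rk₀ ⊥  ≤⟨ contractFirst-gain-antitone ⊥⊆ ⟩
        rk₀ A + rk₁ ⊥  ≡⟨ ≡.cong (rk₀ A +_) loop⊥ ⟩
        rk₀ A + rk₀ ⊥  ∎))
      (deleteFirst≤contractFirst A)

    contractFirst-coloop : rk₁ ⊤ ≡ suc (rk₀ ⊤) → ∀ A → rk₁ A ≡ suc (rk₀ A)
    contractFirst-coloop coloop⊤ A = ℕ.≤-antisym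
      (contractFirst≤1+deleteFirst A)
      (ℕ.+-cancelˡ-≤ (rk₀ ⊤) (suc (rk₀ A)) (rk₁ A) (begin
        rk₀ ⊤ + suc (rk₀ A)  ≡⟨ ℕ.+-suc (rk₀ ⊤) (rk₀ A) ⟩
        suc (rk₀ ⊤) + rk₀ A  ≡⟨ ≡.cong (_+ rk₀ A) coloop⊤ ⟨
        rk₁ ⊤ + rk₀ A        ≤⟨ contractFirst-gain-antitone ⊆⊤ ⟩
        rk₀ ⊤ + rk₁ A        ∎))

    classifyFirst : FirstElement rk
    classifyFirst with rk₁ ⊥ ℕ.≟ rk₀ ⊥ | rk₁ ⊤ ℕ.≟ suc (rk₀ ⊤)
    ... | yes loop⊥ | _           = loop (contractFirst-loop loop⊥)
    ... | no _      | yes coloop⊤ = coloop (contractFirst-coloop coloop⊤)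
    ... | no ¬loop  | no ¬coloop  = neither
      (ℕ.≤-antisym (contractFirst≤1+deleteFirst ⊥)
                   (ℕ.≤∧≢⇒< (deleteFirst≤contractFirst ⊥) (¬loop ∘ ≡.sym)))
      (ℕ.≤-antisym (ℕ.s≤s⁻¹ (ℕ.≤∧≢⇒< (contractFirst≤1+deleteFirst ⊤) ¬coloop))
                   (deleteFirst≤contractFirst ⊤))

module _ {c ℓ₁ ℓ₂} (𝕂 : OrderedCommutativeRing c ℓ₁ ℓ₂) where

  open OrderedCommutativeRing 𝕂
  open RingProperties ring
    using (-1*x≈-x; -‿distribˡ-*; -‿distribʳ-*; x[y-z]≈xy-xz; [y-z]x≈yx-zx)
  open AbelianGroupProperties +-abelianGroup using (⁻¹-involutive; ⁻¹-anti-homo‿-)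
  open CommutativeSemigroupProperties +-commutativeSemigroup
    using (x∙yz≈y∙xz; xy∙z≈x∙zy; interchange)
  open CommutativeSemigroupProperties *-commutativeSemigroup
    using (x∙yz≈y∙zx) renaming (interchange to *-interchange)
  open IsTotalOrder isTotalOrder
    using (total) renaming (≲-respʳ-≈ to ≤-respʳ-≈; ≲-respˡ-≈ to ≤-respˡ-≈; trans to ≤-trans)
  open import Relation.Binary.Reasoning.Setoid setoid

  private variable
    X : Set
    R S : Subset n
    f g : Subset n → Carrier

  nonneg-resp-≈ : ∀ {x y} → x ≈ y → 0# ≤ y → 0# ≤ x
  nonneg-resp-≈ x≈y = ≤-respʳ-≈ (sym x≈y)

  +-nonneg : ∀ {x y} → 0# ≤ x → 0# ≤ y → 0# ≤ x + y
  +-nonneg {x} {y} 0≤x 0≤y = ≤-trans (≤-respʳ-≈ (sym (+-identityˡ y)) 0≤y) (+-monoˡ-≤ y 0≤x)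

  0≤1 : 0# ≤ 1#
  0≤1 with total 0# 1#
  ... | inj₁ 0≤1 = 0≤1
  ... | inj₂ 1≤0 = ≤-respʳ-≈ -1*-1≈1 (*-nonneg 0≤-1 0≤-1)
    where
    0≤-1 : 0# ≤ - 1#
    0≤-1 = ≤-respˡ-≈ (-‿inverseʳ 1#) (≤-respʳ-≈ (+-identityˡ (- 1#)) (+-monoˡ-≤ (- 1#) 1≤0))
    -1*-1≈1 : - 1# * - 1# ≈ 1#
    -1*-1≈1 = trans (-1*x≈-x (- 1#)) (⁻¹-involutive 1#)

  if-same : ∀ {x} b → (if b then x else x) ≈ x
  if-same true  = refl
  if-same false = refl

  Σ[_⋯_] : Subset n → Subset n → (Subset n → Carrier) → Carrier
  Σ[ []          ⋯ []          ] f = f []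
  Σ[ outside ∷ R ⋯ outside ∷ S ] f = Σ[ R ⋯ S ] λ A → f (outside ∷ A)
  Σ[ outside ∷ R ⋯ inside  ∷ S ] f =
    Σ[ R ⋯ S ] (λ A → f (outside ∷ A)) + Σ[ R ⋯ S ] (λ A → f (inside ∷ A))
  Σ[ inside  ∷ R ⋯ outside ∷ S ] f = 0#
  Σ[ inside  ∷ R ⋯ inside  ∷ S ] f = Σ[ R ⋯ S ] λ A → f (inside ∷ A)

  Σ-cong : ∀ (R S : Subset n) → (∀ A → R ⊆ A → A ⊆ S → f A ≈ g A) →
           Σ[ R ⋯ S ] f ≈ Σ[ R ⋯ S ] g
  Σ-cong []            []            f≈g = f≈g [] (λ x → x) (λ x → x)
  Σ-cong (outside ∷ R) (outside ∷ S) f≈g = Σ-cong R S λ A R⊆A A⊆S → f≈g _ (out⊆ R⊆A) (out⊆ A⊆S)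
  Σ-cong (outside ∷ R) (inside  ∷ S) f≈g = +-cong
    (Σ-cong R S λ A R⊆A A⊆S → f≈g _ (out⊆ R⊆A) (out⊆ A⊆S))
    (Σ-cong R S λ A R⊆A A⊆S → f≈g _ (out⊆ R⊆A) (s⊆s A⊆S))
  Σ-cong (inside  ∷ R) (outside ∷ S) f≈g = refl
  Σ-cong (inside  ∷ R) (inside  ∷ S) f≈g = Σ-cong R S λ A R⊆A A⊆S → f≈g _ (s⊆s R⊆A) (s⊆s A⊆S)

  Σ-+ : ∀ (R S : Subset n) f g → Σ[ R ⋯ S ] (λ A → f A + g A) ≈ Σ[ R ⋯ S ] f + Σ[ R ⋯ S ] g
  Σ-+ []            []            f g = refl
  Σ-+ (outside ∷ R) (outside ∷ S) f g = Σ-+ R S _ _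
  Σ-+ (outside ∷ R) (inside  ∷ S) f g =
    trans (+-cong (Σ-+ R S _ _) (Σ-+ R S _ _)) (interchange _ _ _ _)
  Σ-+ (inside  ∷ R) (outside ∷ S) f g = sym (+-identityˡ 0#)
  Σ-+ (inside  ∷ R) (inside  ∷ S) f g = Σ-+ R S _ _

  Σ-*ˡ : ∀ (R S : Subset n) x f → Σ[ R ⋯ S ] (λ A → x * f A) ≈ x * Σ[ R ⋯ S ] f
  Σ-*ˡ []            []            x f = refl
  Σ-*ˡ (outside ∷ R) (outside ∷ S) x f = Σ-*ˡ R S x _
  Σ-*ˡ (outside ∷ R) (inside  ∷ S) x f =
    trans (+-cong (Σ-*ˡ R S x _) (Σ-*ˡ R S x _)) (sym (distribˡ x _ _))
  Σ-*ˡ (inside  ∷ R) (outside ∷ S) x f = sym (zeroʳ x)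
  Σ-*ˡ (inside  ∷ R) (inside  ∷ S) x f = Σ-*ˡ R S x _

  Σ-neg : ∀ (R S : Subset n) f → Σ[ R ⋯ S ] (λ A → - f A) ≈ - Σ[ R ⋯ S ] f
  Σ-neg R S f = begin
    Σ[ R ⋯ S ] (λ A → - f A)       ≈⟨ Σ-cong R S (λ A _ _ → sym (-1*x≈-x (f A))) ⟩
    Σ[ R ⋯ S ] (λ A → - 1# * f A)  ≈⟨ Σ-*ˡ R S (- 1#) f ⟩
    - 1# * Σ[ R ⋯ S ] f            ≈⟨ -1*x≈-x _ ⟩
    - Σ[ R ⋯ S ] f                 ∎

  Σ-– : ∀ (R S : Subset n) f g → Σ[ R ⋯ S ] (λ A → f A - g A) ≈ Σ[ R ⋯ S ] f - Σ[ R ⋯ S ] g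
  Σ-– R S f g = trans (Σ-+ R S f _) (+-congˡ (Σ-neg R S g))

  Σ-list-cong : ∀ (xs : List X) {f g : X → Carrier} → (∀ x → f x ≈ g x) →
                Σ-list 𝕂 xs f ≈ Σ-list 𝕂 xs g
  Σ-list-cong []       f≈g = refl
  Σ-list-cong (x ∷ xs) f≈g = +-cong (f≈g x) (Σ-list-cong xs f≈g)

  Σ-list-zero : ∀ (xs : List X) {f : X → Carrier} → (∀ x → f x ≈ 0#) → Σ-list 𝕂 xs f ≈ 0#
  Σ-list-zero xs f≈0 = trans (Σ-list-cong xs f≈0) (zeros xs)
    where
    zeros : ∀ (xs : List X) → Σ-list 𝕂 xs (λ _ → 0#) ≈ 0#
    zeros []       = refl
    zeros (x ∷ xs) = trans (+-identityˡ _) (zeros xs)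

  Σ-list-++ : ∀ (xs ys : List X) f → Σ-list 𝕂 (xs ++ ys) f ≈ Σ-list 𝕂 xs f + Σ-list 𝕂 ys f
  Σ-list-++ []       ys f = sym (+-identityˡ _)
  Σ-list-++ (x ∷ xs) ys f = trans (+-congˡ (Σ-list-++ xs ys f)) (sym (+-assoc _ _ _))

  Σ-list-map : ∀ {Y : Set} (h : X → Y) (xs : List X) f →
               Σ-list 𝕂 (map h xs) f ≈ Σ-list 𝕂 xs (λ x → f (h x))
  Σ-list-map h []       f = refl
  Σ-list-map h (x ∷ xs) f = +-congˡ (Σ-list-map h xs f)

  Σ-list-filter : ∀ {P : X → Set} (P? : ∀ x → Dec (P x)) (xs : List X) f →
                  Σ-list 𝕂 (filter P? xs) f ≈ Σ-list 𝕂 xs (λ x → if does (P? x) then f x else 0#)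
  Σ-list-filter P? []       f = refl
  Σ-list-filter P? (x ∷ xs) f with does (P? x)
  ... | true  = +-congˡ (Σ-list-filter P? xs f)
  ... | false = trans (Σ-list-filter P? xs f) (sym (+-identityˡ _))

  Σ-allSubsets-∷ : ∀ n h → Σ-list 𝕂 (allSubsets (suc n)) h ≈
    Σ-list 𝕂 (allSubsets n) (λ A → h (outside ∷ A)) + Σ-list 𝕂 (allSubsets n) (λ A → h (inside ∷ A))
  Σ-allSubsets-∷ n h = trans (Σ-list-++ (map (outside ∷_) (allSubsets n)) _ h)
                             (+-cong (Σ-list-map _ (allSubsets n) h) (Σ-list-map _ (allSubsets n) h))

  Σ-allSubsets-interval : ∀ n (R S : Subset n) f →
    Σ-list 𝕂 (allSubsets n) (λ A → if does (R ⊆? A) then (if does (A ⊆? S) then f A else 0#) else 0#)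
    ≈ Σ[ R ⋯ S ] f
  Σ-allSubsets-interval zero    []            []            f = +-identityʳ _
  Σ-allSubsets-interval (suc n) (outside ∷ R) (outside ∷ S) f = trans (Σ-allSubsets-∷ n _)
    (trans (+-cong (Σ-allSubsets-interval n R S _) (Σ-list-zero (allSubsets n) (if-same ∘ does ∘ (R ⊆?_))))
           (+-identityʳ _))
  Σ-allSubsets-interval (suc n) (outside ∷ R) (inside  ∷ S) f = trans (Σ-allSubsets-∷ n _)
    (+-cong (Σ-allSubsets-interval n R S _) (Σ-allSubsets-interval n R S _))
  Σ-allSubsets-interval (suc n) (inside  ∷ R) (outside ∷ S) f = trans (Σ-allSubsets-∷ n _)
    (trans (+-cong (Σ-list-zero (allSubsets n) (λ _ → refl))
                   (Σ-list-zero (allSubsets n) (if-same ∘ does ∘ (R ⊆?_))))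
           (+-identityʳ _))
  Σ-allSubsets-interval (suc n) (inside  ∷ R) (inside  ∷ S) f = trans (Σ-allSubsets-∷ n _)
    (trans (+-cong (Σ-list-zero (allSubsets n) (λ _ → refl)) (Σ-allSubsets-interval n R S _))
           (+-identityˡ _))

  Σ-list-interval : ∀ (R S : Subset n) f → Σ-list 𝕂 (interval R S) f ≈ Σ[ R ⋯ S ] f
  Σ-list-interval {n} R S f = begin
    Σ-list 𝕂 (interval R S) f
      ≈⟨ Σ-list-filter (_⊆? S) (filter (R ⊆?_) (allSubsets n)) f ⟩
    Σ-list 𝕂 (filter (R ⊆?_) (allSubsets n)) (λ A → if does (A ⊆? S) then f A else 0#)
      ≈⟨ Σ-list-filter (R ⊆?_) (allSubsets n) _ ⟩
    Σ-list 𝕂 (allSubsets n) (λ A → if does (R ⊆? A) then (if does (A ⊆? S) then f A else 0#) else 0#)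
      ≈⟨ Σ-allSubsets-interval n R S f ⟩
    Σ[ R ⋯ S ] f ∎

  sign-+ : ∀ x y → sign 𝕂 (x ℕ.+ y) ≈ sign 𝕂 x * sign 𝕂 y
  sign-+ zero    y = sym (*-identityˡ _)
  sign-+ (suc x) y = trans (-‿cong (sign-+ x y)) (-‿distribˡ-* _ _)

  sign-squared : ∀ x → sign 𝕂 x * sign 𝕂 x ≈ 1#
  sign-squared zero    = *-identityˡ 1#
  sign-squared (suc x) = begin
    - s * - s    ≈⟨ -‿distribˡ-* s (- s) ⟨
    - (s * - s)  ≈⟨ -‿cong (-‿distribʳ-* s s) ⟨
    - - (s * s)  ≈⟨ ⁻¹-involutive (s * s) ⟩
    s * s        ≈⟨ sign-squared x ⟩
    1#           ∎
    where s = sign 𝕂 x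

  sign-∸ : ∀ {x y} → y ℕ.≤ x → sign 𝕂 (x ∸ y) ≈ sign 𝕂 x * sign 𝕂 y
  sign-∸ {x} {y} y≤x = begin
    sign 𝕂 (x ∸ y)                          ≈⟨ *-identityʳ _ ⟨
    sign 𝕂 (x ∸ y) * 1#                     ≈⟨ *-congˡ (sign-squared y) ⟨
    sign 𝕂 (x ∸ y) * (sign 𝕂 y * sign 𝕂 y)  ≈⟨ *-assoc _ _ _ ⟨
    sign 𝕂 (x ∸ y) * sign 𝕂 y * sign 𝕂 y    ≈⟨ *-congʳ (sign-+ (x ∸ y) y) ⟨
    sign 𝕂 (x ∸ y ℕ.+ y) * sign 𝕂 y
      ≡⟨ ≡.cong (λ k → sign 𝕂 k * sign 𝕂 y) (ℕ.m∸n+n≡m y≤x) ⟩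
    sign 𝕂 x * sign 𝕂 y                     ∎

  *-sign-cancel : ∀ x y z → (x * sign 𝕂 z) * (y * sign 𝕂 z) ≈ x * y
  *-sign-cancel x y z = begin
    (x * sign 𝕂 z) * (y * sign 𝕂 z)  ≈⟨ *-interchange x (sign 𝕂 z) y (sign 𝕂 z) ⟩
    (x * y) * (sign 𝕂 z * sign 𝕂 z)  ≈⟨ *-congˡ (sign-squared z) ⟩
    (x * y) * 1#                     ≈⟨ *-identityʳ _ ⟩
    x * y                            ∎

  powCoeff-zero : ∀ a → powCoeff 𝕂 a 0 ≡ sign 𝕂 a
  powCoeff-zero zero    = ≡.refl
  powCoeff-zero (suc a) = ≡.cong -_ (powCoeff-zero a)

  powCoeff-zero-nonneg : ∀ i → 0# ≤ powCoeff 𝕂 0 i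
  powCoeff-zero-nonneg zero    = 0≤1
  powCoeff-zero-nonneg (suc i) = IsTotalOrder.refl isTotalOrder

  polyCoeff : (Subset n → Carrier) → (Subset n → ℕ) → (Subset n → ℕ) → ℕ → ℕ → Carrier
  polyCoeff w a b i j = Σ[ ⊥ ⋯ ⊤ ] λ A → w A * (powCoeff 𝕂 (a A) i * powCoeff 𝕂 (b A) j)

  polyCoeff-cong : ∀ {w : Subset n → Carrier} a b {a′ b′ : Subset n → ℕ} i j →
                   (∀ A → a A ≡ a′ A) → (∀ A → b A ≡ b′ A) →
                   polyCoeff w a b i j ≈ polyCoeff w a′ b′ i j
  polyCoeff-cong {w = w} a b i j a≗a′ b≗b′ = Σ-cong ⊥ ⊤ λ A _ _ →
    reflexive (≡.cong₂ (λ x y → w A * (powCoeff 𝕂 x i * powCoeff 𝕂 y j)) (a≗a′ A) (b≗b′ A))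

  polyCoeff-∷ : ∀ (w : Subset (suc n) → Carrier) a b i j → polyCoeff w a b i j ≡
    polyCoeff (deleteFirst w) (deleteFirst a) (deleteFirst b) i j +
    polyCoeff (contractFirst w) (contractFirst a) (contractFirst b) i j
  polyCoeff-∷ w a b i j = ≡.refl

  module _ (w : Subset n → Carrier) (a b : Subset n → ℕ) where

    polyCoeff-– : ∀ (w′ : Subset n → Carrier) i j →
                  polyCoeff w a b i j - polyCoeff w′ a b i j ≈ polyCoeff (λ A → w A - w′ A) a b i j
    polyCoeff-– w′ i j = sym (trans (Σ-cong ⊥ ⊤ λ A _ _ → [y-z]x≈yx-zx _ (w A) (w′ A))
                                    (Σ-– (⊥ {n}) ⊤ _ _))

    polyCoeff-sucʸ : ∀ i j → polyCoeff w a (λ A → suc (b A)) i (suc j)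
                             ≈ polyCoeff w a b i j - polyCoeff w a b i (suc j)
    polyCoeff-sucʸ i j = trans (Σ-cong ⊥ ⊤ λ A _ _ →
      trans (*-congˡ (x[y-z]≈xy-xz _ _ _)) (x[y-z]≈xy-xz (w A) _ _)) (Σ-– (⊥ {n}) ⊤ _ _)

    polyCoeff-sucʸ-zero : ∀ i → polyCoeff w a (λ A → suc (b A)) i 0 ≈ - polyCoeff w a b i 0
    polyCoeff-sucʸ-zero i = trans (Σ-cong ⊥ ⊤ λ A _ _ →
      trans (*-congˡ (sym (-‿distribʳ-* _ _))) (sym (-‿distribʳ-* (w A) _))) (Σ-neg (⊥ {n}) ⊤ _)

    polyCoeff-sucˣ : ∀ i j → polyCoeff w (λ A → suc (a A)) b (suc i) j
                             ≈ polyCoeff w a b i j - polyCoeff w a b (suc i) j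
    polyCoeff-sucˣ i j = trans (Σ-cong ⊥ ⊤ λ A _ _ →
      trans (*-congˡ ([y-z]x≈yx-zx _ _ _)) (x[y-z]≈xy-xz (w A) _ _)) (Σ-– (⊥ {n}) ⊤ _ _)

    polyCoeff-sucˣ-zero : ∀ j → polyCoeff w (λ A → suc (a A)) b 0 j ≈ - polyCoeff w a b 0 j
    polyCoeff-sucˣ-zero j = trans (Σ-cong ⊥ ⊤ λ A _ _ →
      trans (*-congˡ (sym (-‿distribˡ-* _ _))) (sym (-‿distribʳ-* (w A) _))) (Σ-neg (⊥ {n}) ⊤ _)

  tutteCoeff′ : (Subset n → ℕ) → (Subset n → Carrier) → ℕ → ℕ → Carrier
  tutteCoeff′ rk g = polyCoeff g (corank rk) (nullity rk)

  module _ (rk : Subset (suc n) → ℕ) (g : Subset (suc n) → Carrier) where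
    private
      rk₀ rk₁ : Subset n → ℕ
      rk₀ = deleteFirst rk
      rk₁ = contractFirst rk
      g₀ g₁ : Subset n → Carrier
      g₀ = deleteFirst g
      g₁ = contractFirst g

      deleted contracted : ℕ → ℕ → Carrier
      deleted    = polyCoeff g₀ (deleteFirst (corank rk)) (nullity rk₀)
      contracted = polyCoeff g₁ (contractFirst (corank rk)) (contractFirst (nullity rk))

      split : ∀ i j → tutteCoeff′ rk g i j ≡ deleted i j + contracted i j
      split = polyCoeff-∷ g (corank rk) (nullity rk)

    tutteCoeff′-neither : rk₁ ⊥ ≡ suc (rk₀ ⊥) → rk₁ ⊤ ≡ rk₀ ⊤ → ∀ i j →
      tutteCoeff′ rk g i j ≈ tutteCoeff′ rk₀ g₀ i j + tutteCoeff′ rk₁ g₁ i j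
    tutteCoeff′-neither rk₁⊥ rk₁⊤ i j = begin
      tutteCoeff′ rk g i j   ≡⟨ split i j ⟩
      deleted i j + contracted i j
        ≈⟨ +-cong
             (polyCoeff-cong (deleteFirst (corank rk)) (nullity rk₀) i j
                             (λ A → ≡.cong (_∸ rk₀ A) rk₁⊤) (λ _ → ≡.refl))
             (polyCoeff-cong (contractFirst (corank rk)) (contractFirst (nullity rk)) i j
                             (λ _ → ≡.refl) λ A → ≡.cong (_∸ rk₁ A) (≡.trans
                               (≡.sym (ℕ.+-suc ∣ A ∣ (rk₀ ⊥)))
                               (≡.cong (∣ A ∣ ℕ.+_) (≡.sym rk₁⊥)))) ⟩
      tutteCoeff′ rk₀ g₀ i j + tutteCoeff′ rk₁ g₁ i j ∎

    module _ (isRk : IsShiftedMatroid rk) (rk₁≗rk₀ : ∀ A → rk₁ A ≡ rk₀ A) where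
      open IsShiftedMatroid (deleteFirst-isShiftedMatroid isRk)

      private
        P P⁺ : (Subset n → Carrier) → ℕ → ℕ → Carrier
        P  w = polyCoeff w (corank rk₀) (nullity rk₀)
        P⁺ w = polyCoeff w (corank rk₀) (λ A → suc (nullity rk₀ A))

        loop-split : ∀ i j → tutteCoeff′ rk g i j ≈ P g₀ i j + P⁺ g₁ i j
        loop-split i j = begin
          tutteCoeff′ rk g i j  ≡⟨ split i j ⟩
          deleted i j + contracted i j
            ≈⟨ +-cong
                 (polyCoeff-cong (deleteFirst (corank rk)) (nullity rk₀) i j
                                 (λ A → ≡.cong (_∸ rk₀ A) (rk₁≗rk₀ ⊤)) (λ _ → ≡.refl))
                 (polyCoeff-cong (contractFirst (corank rk)) (contractFirst (nullity rk)) i j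
                                 (λ A → ≡.cong₂ _∸_ (rk₁≗rk₀ ⊤) (rk₁≗rk₀ A)) λ A →
                   ≡.trans (≡.cong (suc (∣ A ∣ ℕ.+ rk₀ ⊥) ∸_) (rk₁≗rk₀ A))
                           (ℕ.+-∸-assoc 1 (rk-bounded A))) ⟩
          P g₀ i j + P⁺ g₁ i j ∎

        contraction≈deletion : ∀ i j → tutteCoeff′ rk₁ g₁ i j ≈ P g₁ i j
        contraction≈deletion i j = polyCoeff-cong (corank rk₁) (nullity rk₁) i j
          (λ A → ≡.cong₂ _∸_ (rk₁≗rk₀ ⊤) (rk₁≗rk₀ A))
          (λ A → ≡.cong₂ _∸_ (≡.cong (∣ A ∣ ℕ.+_) (rk₁≗rk₀ ⊥)) (rk₁≗rk₀ A))

      tutteCoeff′-loop-zero : ∀ i → tutteCoeff′ rk g i 0 ≈ tutteCoeff′ rk₀ (λ A → g₀ A - g₁ A) i 0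
      tutteCoeff′-loop-zero i = begin
        tutteCoeff′ rk g i 0                     ≈⟨ loop-split i 0 ⟩
        P g₀ i 0 + P⁺ g₁ i 0
          ≈⟨ +-congˡ (polyCoeff-sucʸ-zero g₁ (corank rk₀) (nullity rk₀) i) ⟩
        P g₀ i 0 - P g₁ i 0
          ≈⟨ polyCoeff-– g₀ (corank rk₀) (nullity rk₀) g₁ i 0 ⟩
        tutteCoeff′ rk₀ (λ A → g₀ A - g₁ A) i 0  ∎

      tutteCoeff′-loop-suc : ∀ i j → tutteCoeff′ rk g i (suc j) ≈
        tutteCoeff′ rk₁ g₁ i j + tutteCoeff′ rk₀ (λ A → g₀ A - g₁ A) i (suc j)
      tutteCoeff′-loop-suc i j = begin
        tutteCoeff′ rk g i (suc j)                    ≈⟨ loop-split i (suc j) ⟩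
        P g₀ i (suc j) + P⁺ g₁ i (suc j)
          ≈⟨ +-congˡ (polyCoeff-sucʸ g₁ (corank rk₀) (nullity rk₀) i j) ⟩
        P g₀ i (suc j) + (P g₁ i j - P g₁ i (suc j))  ≈⟨ x∙yz≈y∙xz _ _ _ ⟩
        P g₁ i j + (P g₀ i (suc j) - P g₁ i (suc j))
          ≈⟨ +-cong (sym (contraction≈deletion i j))
                    (polyCoeff-– g₀ (corank rk₀) (nullity rk₀) g₁ i (suc j)) ⟩
        tutteCoeff′ rk₁ g₁ i j + tutteCoeff′ rk₀ (λ A → g₀ A - g₁ A) i (suc j) ∎

    module _ (isRk : IsShiftedMatroid rk) (rk₁≗1+rk₀ : ∀ A → rk₁ A ≡ suc (rk₀ A)) where
      open IsShiftedMatroid (deleteFirst-isShiftedMatroid isRk)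

      private
        P P⁺ : (Subset n → Carrier) → ℕ → ℕ → Carrier
        P  w = polyCoeff w (corank rk₀) (nullity rk₀)
        P⁺ w = polyCoeff w (λ A → suc (corank rk₀ A)) (nullity rk₀)

        coloop-split : ∀ i j → tutteCoeff′ rk g i j ≈ P⁺ g₀ i j + P g₁ i j
        coloop-split i j = begin
          tutteCoeff′ rk g i j  ≡⟨ split i j ⟩
          deleted i j + contracted i j
            ≈⟨ +-cong
                 (polyCoeff-cong (deleteFirst (corank rk)) (nullity rk₀) i j
                                 (λ A → ≡.trans (≡.cong (_∸ rk₀ A) (rk₁≗1+rk₀ ⊤))
                                                (ℕ.+-∸-assoc 1 (rk-monotone ⊆⊤)))
                                 (λ _ → ≡.refl))
                 (polyCoeff-cong (contractFirst (corank rk)) (contractFirst (nullity rk)) i j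
                                 (λ A → ≡.cong₂ _∸_ (rk₁≗1+rk₀ ⊤) (rk₁≗1+rk₀ A))
                                 (λ A → ≡.cong (suc (∣ A ∣ ℕ.+ rk₀ ⊥) ∸_) (rk₁≗1+rk₀ A))) ⟩
          P⁺ g₀ i j + P g₁ i j ∎

      tutteCoeff′-coloop-zero : ∀ j → tutteCoeff′ rk g 0 j ≈ tutteCoeff′ rk₀ (λ A → g₁ A - g₀ A) 0 j
      tutteCoeff′-coloop-zero j = begin
        tutteCoeff′ rk g 0 j                     ≈⟨ coloop-split 0 j ⟩
        P⁺ g₀ 0 j + P g₁ 0 j
          ≈⟨ +-congʳ (polyCoeff-sucˣ-zero g₀ (corank rk₀) (nullity rk₀) j) ⟩
        - P g₀ 0 j + P g₁ 0 j                    ≈⟨ +-comm _ _ ⟩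
        P g₁ 0 j - P g₀ 0 j
          ≈⟨ polyCoeff-– g₁ (corank rk₀) (nullity rk₀) g₀ 0 j ⟩
        tutteCoeff′ rk₀ (λ A → g₁ A - g₀ A) 0 j  ∎

      tutteCoeff′-coloop-suc : ∀ i j → tutteCoeff′ rk g (suc i) j ≈
        tutteCoeff′ rk₀ g₀ i j + tutteCoeff′ rk₀ (λ A → g₁ A - g₀ A) (suc i) j
      tutteCoeff′-coloop-suc i j = begin
        tutteCoeff′ rk g (suc i) j                    ≈⟨ coloop-split (suc i) j ⟩
        P⁺ g₀ (suc i) j + P g₁ (suc i) j
          ≈⟨ +-congʳ (polyCoeff-sucˣ g₀ (corank rk₀) (nullity rk₀) i j) ⟩
        (P g₀ i j - P g₀ (suc i) j) + P g₁ (suc i) j  ≈⟨ xy∙z≈x∙zy _ _ _ ⟩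
        P g₀ i j + (P g₁ (suc i) j - P g₀ (suc i) j)
          ≈⟨ +-congˡ (polyCoeff-– g₁ (corank rk₀) (nullity rk₀) g₀ (suc i) j) ⟩
        tutteCoeff′ rk₀ g₀ i j + tutteCoeff′ rk₀ (λ A → g₁ A - g₀ A) (suc i) j ∎

  alternating : Subset n → Subset n → (Subset n → Carrier) → Carrier
  alternating R S g = Σ[ R ⋯ S ] λ A → sign 𝕂 (∣ S ∣ ∸ ∣ A ∣) * g A

  ρ′ : (Subset n → Carrier) → (R S T : Subset n) → Carrier
  ρ′ g R S T = sign 𝕂 ∣ T ∣ * alternating R S g

  ρ≈ρ′ : ∀ (g : Subset n → Carrier) R S T → ρ 𝕂 g R S T ≈ ρ′ g R S T
  ρ≈ρ′ g R S T = *-congˡ (Σ-list-interval R S _)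

  HasNonnegMolecules : (Subset n → ℕ) → (Subset n → Carrier) → Set ℓ₂
  HasNonnegMolecules {n} rk g =
    ∀ (R S F T : Subset n) → IsMolecule 𝕂 rk R S F T → 0# ≤ ρ′ g R S T

  molecule-∷ : ∀ {rk : Subset (suc n) → ℕ} {rk′ : Subset n → ℕ} {R S F T : Subset n} r f t →
    r ∧ f ≡ outside → r ∧ t ≡ outside → f ∧ t ≡ outside → IsMolecule 𝕂 rk′ R S F T →
    (∀ A → r ∷ R ⊆ A → A ⊆ (r ∨ f ∨ t) ∷ S → rk A ≡ rk (r ∷ R) ℕ.+ ∣ A ∩ (f ∷ F) ∣) →
    IsMolecule 𝕂 rk (r ∷ R) ((r ∨ f ∨ t) ∷ S) (f ∷ F) (t ∷ T)
  molecule-∷ r f t r∧f r∧t f∧t mol rank≡′ = record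
    { R∩F   = ≡.cong₂ _∷_ r∧f R∩F
    ; R∩T   = ≡.cong₂ _∷_ r∧t R∩T
    ; F∩T   = ≡.cong₂ _∷_ f∧t F∩T
    ; S≡    = ≡.cong ((r ∨ f ∨ t) ∷_) S≡
    ; rank≡ = rank≡′
    }
    where open IsMolecule mol

  module _ {rk : Subset (suc n) → ℕ} {g : Subset (suc n) → Carrier}
           (nonneg : HasNonnegMolecules rk g) where
    private
      rk₀ rk₁ : Subset n → ℕ
      rk₀ = deleteFirst rk
      rk₁ = contractFirst rk
      g₀ g₁ : Subset n → Carrier
      g₀ = deleteFirst g
      g₁ = contractFirst g

    deleteFirst-nonnegMolecules : HasNonnegMolecules rk₀ g₀
    deleteFirst-nonnegMolecules R S F T mol =
      nonneg _ _ _ _ (molecule-∷ outside outside outside ≡.refl ≡.refl ≡.refl mol λ where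
        (outside ∷ A) R⊆A A⊆S → rank≡ A (drop-∷-⊆ R⊆A) (drop-∷-⊆ A⊆S)
        (inside  ∷ A) R⊆A A⊆S → contradiction (A⊆S here) λ ())
      where open IsMolecule mol

    contractFirst-nonnegMolecules : HasNonnegMolecules rk₁ g₁
    contractFirst-nonnegMolecules R S F T mol =
      nonneg _ _ _ _ (molecule-∷ inside outside outside ≡.refl ≡.refl ≡.refl mol λ where
        (inside  ∷ A) R⊆A A⊆S → rank≡ A (drop-∷-⊆ R⊆A) (drop-∷-⊆ A⊆S)
        (outside ∷ A) R⊆A A⊆S → contradiction (R⊆A here) λ ())
      where open IsMolecule mol

    private
      -x*y+x*z≈x*[z-y] : ∀ x y z → - x * y + x * z ≈ x * (z - y)
      -x*y+x*z≈x*[z-y] x y z = begin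
        - x * y + x * z    ≈⟨ +-congʳ (-‿distribˡ-* x y) ⟨
        - (x * y) + x * z  ≈⟨ +-comm _ _ ⟩
        x * z - x * y      ≈⟨ x[y-z]≈xy-xz x z y ⟨
        x * (z - y)        ∎

      alternating-first∈S∖R : ∀ (R S : Subset n) →
        alternating (outside ∷ R) (inside ∷ S) g ≈ alternating R S (λ A → g₁ A - g₀ A)
      alternating-first∈S∖R R S =
        trans (sym (Σ-+ R S (λ A → sign 𝕂 (suc ∣ S ∣ ∸ ∣ A ∣) * g₀ A)
                            (λ A → sign 𝕂 (∣ S ∣ ∸ ∣ A ∣) * g₁ A)))
              (Σ-cong R S λ A _ A⊆S → trans
                (+-congʳ (*-congʳ (reflexive
                  (≡.cong (sign 𝕂) (ℕ.+-∸-assoc 1 (p⊆q⇒∣p∣≤∣q∣ A⊆S))))))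
                (-x*y+x*z≈x*[z-y] _ _ _))

    loop-nonnegMolecules : (∀ A → rk₁ A ≡ rk₀ A) → HasNonnegMolecules rk₀ (λ A → g₀ A - g₁ A)
    loop-nonnegMolecules rk₁≗rk₀ R S F T mol = nonneg-resp-≈ (sym ρ-loop)
      (nonneg _ _ _ _ (molecule-∷ outside outside inside ≡.refl ≡.refl ≡.refl mol λ where
        (outside ∷ A) R⊆A A⊆S → rank≡ A (drop-∷-⊆ R⊆A) (drop-∷-⊆ A⊆S)
        (inside  ∷ A) R⊆A A⊆S → ≡.trans (rk₁≗rk₀ A) (rank≡ A (drop-∷-⊆ R⊆A) (drop-∷-⊆ A⊆S))))
      where
      open IsMolecule mol
      s = sign 𝕂 ∣ T ∣
      ρ-loop : ρ′ g (outside ∷ R) (inside ∷ S) (inside ∷ T) ≈ ρ′ (λ A → g₀ A - g₁ A) R S T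
      ρ-loop = begin
        - s * alternating (outside ∷ R) (inside ∷ S) g  ≈⟨ *-congˡ (alternating-first∈S∖R R S) ⟩
        - s * alternating R S (λ A → g₁ A - g₀ A)       ≈⟨ -‿distribˡ-* s _ ⟨
        - (s * alternating R S (λ A → g₁ A - g₀ A))     ≈⟨ -‿distribʳ-* s _ ⟩
        s * - alternating R S (λ A → g₁ A - g₀ A)       ≈⟨ *-congˡ (Σ-neg R S _) ⟨
        s * Σ[ R ⋯ S ] (λ A → - (sign 𝕂 (∣ S ∣ ∸ ∣ A ∣) * (g₁ A - g₀ A)))
          ≈⟨ *-congˡ (Σ-cong R S λ A _ _ →
               trans (-‿distribʳ-* _ _) (*-congˡ (⁻¹-anti-homo‿- (g₁ A) (g₀ A)))) ⟩
        s * alternating R S (λ A → g₀ A - g₁ A)         ∎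

    coloop-nonnegMolecules : (∀ A → rk₁ A ≡ suc (rk₀ A)) → HasNonnegMolecules rk₀ (λ A → g₁ A - g₀ A)
    coloop-nonnegMolecules rk₁≗1+rk₀ R S F T mol =
      nonneg-resp-≈ (sym (*-congˡ (alternating-first∈S∖R R S)))
      (nonneg _ _ _ _ (molecule-∷ outside inside outside ≡.refl ≡.refl ≡.refl mol λ where
        (outside ∷ A) R⊆A A⊆S → rank≡ A (drop-∷-⊆ R⊆A) (drop-∷-⊆ A⊆S)
        (inside  ∷ A) R⊆A A⊆S → ≡.trans (rk₁≗1+rk₀ A) (≡.trans
          (≡.cong suc (rank≡ A (drop-∷-⊆ R⊆A) (drop-∷-⊆ A⊆S))) (≡.sym (ℕ.+-suc _ _)))))
      where open IsMolecule mol

  tutteCoeff′-nonneg : ∀ n (rk : Subset n → ℕ) g → IsShiftedMatroid rk → HasNonnegMolecules rk g →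
                       ∀ i j → 0# ≤ tutteCoeff′ rk g i j
  tutteCoeff′-nonneg zero rk g _ nonneg i j = nonneg-resp-≈ tutte[]
    (*-nonneg 0≤g[] (*-nonneg (powCoeff-zero-nonneg i) (powCoeff-zero-nonneg j)))
    where
    emptyMolecule : IsMolecule 𝕂 rk [] [] [] []
    emptyMolecule = record
      { R∩F = ≡.refl ; R∩T = ≡.refl ; F∩T = ≡.refl ; S≡ = ≡.refl
      ; rank≡ = λ { [] _ _ → ≡.sym (ℕ.+-identityʳ (rk [])) } }
    0≤g[] : 0# ≤ g []
    0≤g[] = ≤-respʳ-≈ (trans (*-identityˡ _) (*-identityˡ _)) (nonneg [] [] [] [] emptyMolecule)
    tutte[] : tutteCoeff′ rk g i j ≈ g [] * (powCoeff 𝕂 0 i * powCoeff 𝕂 0 j)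
    tutte[] = reflexive (≡.cong₂ (λ a b → g [] * (powCoeff 𝕂 a i * powCoeff 𝕂 b j))
                                 (ℕ.n∸n≡0 (rk [])) (ℕ.n∸n≡0 (rk [])))
  tutteCoeff′-nonneg (suc n) rk g isRk nonneg = byFirstElement (classifyFirst isRk)
    where
    ih₀ : ∀ {h} → HasNonnegMolecules (deleteFirst rk) h →
          ∀ i j → 0# ≤ tutteCoeff′ (deleteFirst rk) h i j
    ih₀ = tutteCoeff′-nonneg n _ _ (deleteFirst-isShiftedMatroid isRk)
    ih₁ : ∀ {h} → HasNonnegMolecules (contractFirst rk) h →
          ∀ i j → 0# ≤ tutteCoeff′ (contractFirst rk) h i j
    ih₁ = tutteCoeff′-nonneg n _ _ (contractFirst-isShiftedMatroid isRk)
    byFirstElement : FirstElement rk → ∀ i j → 0# ≤ tutteCoeff′ rk g i j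
    byFirstElement (loop e) i zero = nonneg-resp-≈ (tutteCoeff′-loop-zero rk g isRk e i)
      (ih₀ (loop-nonnegMolecules nonneg e) i 0)
    byFirstElement (loop e) i (suc j) = nonneg-resp-≈ (tutteCoeff′-loop-suc rk g isRk e i j)
      (+-nonneg (ih₁ (contractFirst-nonnegMolecules nonneg) i j) (ih₀ (loop-nonnegMolecules nonneg e) i (suc j)))
    byFirstElement (coloop e) zero j = nonneg-resp-≈ (tutteCoeff′-coloop-zero rk g isRk e j)
      (ih₀ (coloop-nonnegMolecules nonneg e) 0 j)
    byFirstElement (coloop e) (suc i) j = nonneg-resp-≈ (tutteCoeff′-coloop-suc rk g isRk e i j)
      (+-nonneg (ih₀ (deleteFirst-nonnegMolecules nonneg) i j) (ih₀ (coloop-nonnegMolecules nonneg e) (suc i) j))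
    byFirstElement (neither e⊥ e⊤) i j = nonneg-resp-≈ (tutteCoeff′-neither rk g e⊥ e⊤ i j)
      (+-nonneg (ih₀ (deleteFirst-nonnegMolecules nonneg) i j) (ih₁ (contractFirst-nonnegMolecules nonneg) i j))

  pseudoArithmetic⇒nonnegTutte : ∀ (rk : Subset n → ℕ) m →
                                 IsPseudoArithmetic 𝕂 rk m → NonnegTutte 𝕂 rk m ⊤
  pseudoArithmetic⇒nonnegTutte {n} rk m (isMatroid , nonneg) i j = nonneg-resp-≈ tutte≈tutte′
    (tutteCoeff′-nonneg n rk m (isMatroid⇒isShiftedMatroid isMatroid)
      (λ R S F T mol → ≤-respʳ-≈ (ρ≈ρ′ m R S T) (nonneg R S F T mol)) i j)
    where
    tutte≈tutte′ : tutteCoeff 𝕂 rk m ⊤ i j ≈ tutteCoeff′ rk m i j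
    tutte≈tutte′ = trans (Σ-list-interval (⊥ {n}) ⊤ _)
      (polyCoeff-cong (corank rk) (λ A → ∣ A ∣ ∸ rk A) i j (λ _ → ≡.refl)
                      (λ A → ≡.cong (_∸ rk A) (≡.sym (∣A∣+rk⊥≡∣A∣ isMatroid A))))

  -- ⊤ ─ (R ∪ ∁ S) is S ∖ R, written as the ground set ⊤ ─ (R ∪ D) of a minor with D = ∁ S.
  Σ-shift : ∀ (R S : Subset n) → R ⊆ S → ∀ f →
            Σ[ R ⋯ S ] f ≈ Σ[ ⊥ ⋯ ⊤ ─ (R ∪ ∁ S) ] (λ A → f (A ∪ R))
  Σ-shift []            []            _   f = refl
  Σ-shift (outside ∷ R) (outside ∷ S) R⊆S f = Σ-shift R S (drop-∷-⊆ R⊆S) _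
  Σ-shift (outside ∷ R) (inside  ∷ S) R⊆S f =
    +-cong (Σ-shift R S (drop-∷-⊆ R⊆S) _) (Σ-shift R S (drop-∷-⊆ R⊆S) _)
  Σ-shift (inside  ∷ R) (inside  ∷ S) R⊆S f = Σ-shift R S (drop-∷-⊆ R⊆S) _
  Σ-shift (inside  ∷ R) (outside ∷ S) R⊆S f = contradiction (R⊆S here) λ ()

  module _ {rk : Subset n → ℕ} {R S F T : Subset n} (mol : IsMolecule 𝕂 rk R S F T) where
    open IsMolecule mol

    R⊆S : R ⊆ S
    R⊆S = ≡.subst (R ⊆_) (≡.sym S≡) (p⊆p∪q (F ∪ T))

    private
      G : Subset n
      G = ⊤ ─ (R ∪ ∁ S)

      F⊆S : F ⊆ S
      F⊆S = ≡.subst (F ⊆_) (≡.sym S≡) (q⊆p∪q R (F ∪ T) ∘ p⊆p∪q T)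

      ∈G⇒∈S : ∀ {x} → x ∈ G → x ∈ S
      ∈G⇒∈S x∈G = x∉∁p⇒x∈p (x∈p─q⇒x∉q x∈G ∘ x∈p∪q⁺ ∘ inj₂)

      ∈G⇒∉R : ∀ {x} → x ∈ G → x ∉ R
      ∈G⇒∉R x∈G = x∈p─q⇒x∉q x∈G ∘ x∈p∪q⁺ ∘ inj₁

      F⊆G : F ⊆ G
      F⊆G x∈F = x∈p∧x∉q⇒x∈p─q ∈⊤ λ x∈R∪∁S →
        [ (λ x∈R → disjoint⁻ R∩F x∈R x∈F) , (λ x∈∁S → x∈∁p⇒x∉p x∈∁S (F⊆S x∈F)) ]′
        (x∈p∪q⁻ R (∁ S) x∈R∪∁S)

      ∣S∣≡ : ∣ S ∣ ≡ ∣ R ∣ ℕ.+ (∣ F ∣ ℕ.+ ∣ T ∣)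
      ∣S∣≡ = ≡.trans (≡.cong ∣_∣ S≡) (≡.trans (∣p∪q∣≡∣p∣+∣q∣ R∩[F∪T])
                                            (≡.cong (∣ R ∣ ℕ.+_) (∣p∪q∣≡∣p∣+∣q∣ F∩T)))
        where
        R∩[F∪T] : Disjoint R (F ∪ T)
        R∩[F∪T] = ≡.trans (∩-distribˡ-∪ R F T) (≡.trans (≡.cong₂ _∪_ R∩F R∩T) (∪-identityˡ ⊥))

      module _ {A : Subset n} (A⊆G : A ⊆ G) where

        A∪R⊆S : A ∪ R ⊆ S
        A∪R⊆S x∈A∪R = [ ∈G⇒∈S ∘ A⊆G , R⊆S ]′ (x∈p∪q⁻ A R x∈A∪R)

        ∣A∪R∣≡ : ∣ A ∪ R ∣ ≡ ∣ A ∣ ℕ.+ ∣ R ∣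
        ∣A∪R∣≡ = ∣p∪q∣≡∣p∣+∣q∣ (disjoint⁺ (∈G⇒∉R ∘ A⊆G))

        contractRk≡ : contractRk rk R A ≡ ∣ A ∩ F ∣
        contractRk≡ = ≡.trans (≡.cong (_∸ rk R) (rank≡ (A ∪ R) (q⊆p∪q A R) A∪R⊆S))
                      (≡.trans (ℕ.m+n∸m≡n (rk R) _) (≡.cong ∣_∣ [A∪R]∩F≡A∩F))
          where
          [A∪R]∩F≡A∩F : (A ∪ R) ∩ F ≡ A ∩ F
          [A∪R]∩F≡A∩F =
            ≡.trans (∩-distribʳ-∪ F A R) (≡.trans (≡.cong (A ∩ F ∪_) R∩F) (∪-identityʳ _))

        sign-exponents : sign 𝕂 ∣ T ∣ * sign 𝕂 (∣ S ∣ ∸ ∣ A ∪ R ∣) ≈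
                         sign 𝕂 (∣ F ∣ ∸ ∣ A ∩ F ∣) * sign 𝕂 (∣ A ∣ ∸ ∣ A ∩ F ∣)
        sign-exponents = begin
          sT * sign 𝕂 (∣ S ∣ ∸ ∣ A ∪ R ∣)
            ≈⟨ *-congˡ (sign-∸ (p⊆q⇒∣p∣≤∣q∣ A∪R⊆S)) ⟩
          sT * (sign 𝕂 ∣ S ∣ * sign 𝕂 ∣ A ∪ R ∣)  ≈⟨ *-congˡ (*-cong sign-S sign-A∪R) ⟩
          sT * ((sR * (sF * sT)) * (sA * sR))     ≈⟨ *-congˡ (*-congʳ (*-comm sR _)) ⟩
          sT * (((sF * sT) * sR) * (sA * sR))     ≈⟨ *-congˡ (*-sign-cancel _ _ ∣ R ∣) ⟩
          sT * ((sF * sT) * sA)                   ≈⟨ x∙yz≈y∙zx sT (sF * sT) sA ⟩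
          (sF * sT) * (sA * sT)                   ≈⟨ *-sign-cancel sF sA ∣ T ∣ ⟩
          sF * sA                                 ≈⟨ *-sign-cancel sF sA ∣ A ∩ F ∣ ⟨
          (sF * sign 𝕂 ∣ A ∩ F ∣) * (sA * sign 𝕂 ∣ A ∩ F ∣)
            ≈⟨ *-cong (sign-∸ (∣p∩q∣≤∣q∣ A F)) (sign-∸ (∣p∩q∣≤∣p∣ A F)) ⟨
          sign 𝕂 (∣ F ∣ ∸ ∣ A ∩ F ∣) * sign 𝕂 (∣ A ∣ ∸ ∣ A ∩ F ∣) ∎
          where
          sT = sign 𝕂 ∣ T ∣
          sR = sign 𝕂 ∣ R ∣
          sF = sign 𝕂 ∣ F ∣
          sA = sign 𝕂 ∣ A ∣
          sign-S : sign 𝕂 ∣ S ∣ ≈ sR * (sF * sT)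
          sign-S = trans (reflexive (≡.cong (sign 𝕂) ∣S∣≡))
                         (trans (sign-+ ∣ R ∣ _) (*-congˡ (sign-+ ∣ F ∣ ∣ T ∣)))
          sign-A∪R : sign 𝕂 ∣ A ∪ R ∣ ≈ sA * sR
          sign-A∪R = trans (reflexive (≡.cong (sign 𝕂) ∣A∪R∣≡)) (sign-+ ∣ A ∣ ∣ R ∣)

    ρ≈minorConstantTerm : ∀ (m : Subset n → Carrier) →
      ρ 𝕂 m R S T ≈ tutteCoeff 𝕂 (contractRk rk R) (contractM 𝕂 m R) (⊤ ─ (R ∪ ∁ S)) 0 0
    ρ≈minorConstantTerm m = begin
      ρ 𝕂 m R S T                                 ≈⟨ ρ≈ρ′ m R S T ⟩
      t * Σ[ R ⋯ S ] term                         ≈⟨ *-congˡ (Σ-shift R S R⊆S term) ⟩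
      t * Σ[ ⊥ ⋯ G ] (λ A → term (A ∪ R))         ≈⟨ Σ-*ˡ ⊥ G t _ ⟨
      Σ[ ⊥ ⋯ G ] (λ A → t * term (A ∪ R))         ≈⟨ Σ-cong ⊥ G (λ A _ A⊆G → summand A⊆G) ⟩
      Σ[ ⊥ ⋯ G ] minorSummand                     ≈⟨ Σ-list-interval ⊥ G minorSummand ⟨
      tutteCoeff 𝕂 rk′ (contractM 𝕂 m R) G 0 0    ∎
      where
      t = sign 𝕂 ∣ T ∣
      rk′ = contractRk rk R
      term minorSummand : Subset n → Carrier
      term A = sign 𝕂 (∣ S ∣ ∸ ∣ A ∣) * m A
      minorSummand A = m (A ∪ R) * (powCoeff 𝕂 (rk′ G ∸ rk′ A) 0 * powCoeff 𝕂 (∣ A ∣ ∸ rk′ A) 0)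
      summand : ∀ {A} → A ⊆ G → t * term (A ∪ R) ≈ minorSummand A
      summand {A} A⊆G = begin
        t * (sign 𝕂 (∣ S ∣ ∸ ∣ A ∪ R ∣) * m (A ∪ R))  ≈⟨ *-assoc _ _ _ ⟨
        (t * sign 𝕂 (∣ S ∣ ∸ ∣ A ∪ R ∣)) * m (A ∪ R)  ≈⟨ *-congʳ (sign-exponents A⊆G) ⟩
        (sign 𝕂 (∣ F ∣ ∸ ∣ A ∩ F ∣) * sign 𝕂 (∣ A ∣ ∸ ∣ A ∩ F ∣)) * m (A ∪ R)
                                                      ≈⟨ *-comm _ _ ⟩
        m (A ∪ R) * (sign 𝕂 (∣ F ∣ ∸ ∣ A ∩ F ∣) * sign 𝕂 (∣ A ∣ ∸ ∣ A ∩ F ∣))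
          ≡⟨ ≡.cong₂ (λ x y → m (A ∪ R) * (x * y)) corank≡ nullity≡ ⟨
        minorSummand A                                ∎
        where
        rk′G : rk′ G ≡ ∣ F ∣
        rk′G = ≡.trans (contractRk≡ (λ x → x)) (≡.cong ∣_∣ (p⊆q⇒q∩p≡p F⊆G))
        corank≡ : powCoeff 𝕂 (rk′ G ∸ rk′ A) 0 ≡ sign 𝕂 (∣ F ∣ ∸ ∣ A ∩ F ∣)
        corank≡ = ≡.trans (≡.cong₂ (λ x y → powCoeff 𝕂 (x ∸ y) 0) rk′G (contractRk≡ A⊆G))
                          (powCoeff-zero (∣ F ∣ ∸ ∣ A ∩ F ∣))
        nullity≡ : powCoeff 𝕂 (∣ A ∣ ∸ rk′ A) 0 ≡ sign 𝕂 (∣ A ∣ ∸ ∣ A ∩ F ∣)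
        nullity≡ = ≡.trans (≡.cong (λ y → powCoeff 𝕂 (∣ A ∣ ∸ y) 0) (contractRk≡ A⊆G))
                           (powCoeff-zero (∣ A ∣ ∸ ∣ A ∩ F ∣))

  minorsNonnegTutte⇒pseudoArithmetic : ∀ (rk : Subset n → ℕ) m → IsMatroid rk →
    (∀ (R D : Subset n) → Disjoint R D →
       NonnegTutte 𝕂 (contractRk rk R) (contractM 𝕂 m R) (⊤ ─ (R ∪ D))) →
    IsPseudoArithmetic 𝕂 rk m
  minorsNonnegTutte⇒pseudoArithmetic rk m isMatroid minorsNonneg = isMatroid , λ R S F T mol →
    nonneg-resp-≈ (ρ≈minorConstantTerm mol m)
      (minorsNonneg R (∁ S) (disjoint⁺ λ x∈R x∈∁S → x∈∁p⇒x∉p x∈∁S (R⊆S mol x∈R)) 0 0)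

theorem4p5 : ∀ {c ℓ₁ ℓ₂ : Level} (𝕂 : OrderedCommutativeRing c ℓ₁ ℓ₂) {n : ℕ}
    (rk : Subset n → ℕ) (m : Subset n → OrderedCommutativeRing.Carrier 𝕂) →
    (IsPseudoArithmetic 𝕂 rk m → NonnegTutte 𝕂 rk m ⊤)
    × (IsMatroid rk →
       (∀ (R D : Subset n) → Disjoint R D →
          NonnegTutte 𝕂 (contractRk rk R) (contractM 𝕂 m R) (⊤ ─ (R ∪ D))) →
       IsPseudoArithmetic 𝕂 rk m)
theorem4p5 𝕂 rk m = pseudoArithmetic⇒nonnegTutte 𝕂 rk m , minorsNonnegTutte⇒pseudoArithmetic 𝕂 rk m
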